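{- Let $M$ be a matroid on a finite ground set $E$ with $|E|=n$, and write $F(M,\mathbf{x})=\sum_\alpha c_\alpha M_\alpha$ (sum over compositions $\alpha$ of $n$). Then $c_\alpha$ equals the number of flags of subsets $\emptyset=A_0\subset A_1\subset\cdots\subset A_k=E$ with $(|A_1|-|A_0|,\ldots,|A_k|-|A_{k-1}|)=\alpha$ such that, for each $i=1,\ldots,k$, the matroid $(M|_{A_i})/A_{i-1}$ splits completely.
   Context: For a matroid $M$ on finite ground set $E$ with bases $\mathcal{B}(M)$ and $f:E\to\mathbb{P}=\{1,2,\ldots\}$, $f$ is $M$-generic if the minimum of $f(B)=\sum_{e\in B}f(e)$ over bases is attained uniquely; $F(M,\mathbf{x})=\sum_{f\ M\text{ -generic}}\prod_{e\in E}x_{f(e)}$, a quasisymmetric function. For a composition $\alpha=(\alpha_1,\ldots,\alpha_k)$, the monomial quasisymmetric function is $M_\alpha=\sum_{i_1<\cdots<i_k}x_{i_1}^{\alpha_1}\cdots x_{i_k}^{\alpha_k}$; these form a basis of quasisymmetric functions. $M|_A$ denotes restriction to $A$ and $N/A$ contraction by $A$. A matroid splits completely if it is a direct sum of one-element matroids (loops and isthmuses), equivalently if it has exactly one base. -}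

module Defs where

open import Data.Nat using (ℕ; zero; suc; _+_; _<_)
open import Data.Bool using (Bool; true; false)
open import Data.Fin using (Fin; toℕ) renaming (_≟_ to _≟ᶠ_)
open import Data.Fin.Subset
  using (Subset; ⊤; _∪_; _─_; _-_; ⁅_⁆; ∣_∣)
  renaming (⊥ to ∅; _∈_ to _∈ˢ_; _∉_ to _∉ˢ_; _⊆_ to _⊆ˢ_)
open import Data.Vec using (Vec; []; _∷_; count)
open import Data.List using (List; []; _∷_; length)
open import Data.List.Membership.Propositional using (_∈_)
open import Data.List.Relation.Unary.Unique.Propositional using (Unique)
open import Data.Product using (Σ; ∃; _×_; _,_)
open import Data.Empty renaming (⊥ to Empty)
open import Relation.Nullary using (Dec; ¬_)
open import Relation.Binary.PropositionalEquality using (_≡_; _≢_)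
open import Function.Bundles using (_⇔_)

record Matroid (n : ℕ) : Set₁ where
  field
    IsBase   : Subset n → Set
    isBase?  : (B : Subset n) → Dec (IsBase B)
    base-exists : ∃ IsBase
    exchange : ∀ B₁ B₂ → IsBase B₁ → IsBase B₂ →
               ∀ x → x ∈ˢ B₁ → x ∉ˢ B₂ →
               ∃ λ y → y ∈ˢ B₂ × y ∉ˢ B₁ × IsBase ((B₁ - x) ∪ ⁅ y ⁆)

open Matroid public

module _ {n : ℕ} (M : Matroid n) where

  Indep : Subset n → Set
  Indep I = ∃ λ B → IsBase M B × I ⊆ˢ B

  -- I is a basis of S (a maximal independent subset of S),
  -- i.e. a base of the restriction M|S
  IsBasisOf : Subset n → Subset n → Set
  IsBasisOf S I = I ⊆ˢ S × Indep I ×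
                  (∀ J → I ⊆ˢ J → J ⊆ˢ S → Indep J → J ≡ I)

  -- For C ⊆ A, the bases of the minor (M|A)/C (ground set A ─ C):
  -- X ⊆ A ─ C such that X ∪ I is a base of M|A for a basis I of C.
  IsMinorBase : (C A : Subset n) → Subset n → Set
  IsMinorBase C A X = X ⊆ˢ (A ─ C) ×
                      ∃ λ I → IsBasisOf C I × IsBasisOf A (X ∪ I)

  -- (M|A)/C splits completely: it has exactly one base
  SplitsCompletely : (C A : Subset n) → Set
  SplitsCompletely C A = ∃ λ X → IsMinorBase C A X ×
                           (∀ Y → IsMinorBase C A Y → Y ≡ X)

  -- Flags ∅ = A₀ ⊂ A₁ ⊂ ⋯ ⊂ A_k = E of type α such that each
  -- (M|A_i)/A_{i-1} splits completely.  The list holds A₁,…,A_k;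
  -- the first argument is the previous set A_{i-1}.
  FlagFrom : Subset n → List ℕ → List (Subset n) → Set
  FlagFrom prev []      []       = prev ≡ ⊤
  FlagFrom prev (a ∷ α) (A ∷ As) = prev ⊆ˢ A × ∣ A ∣ ≡ a + ∣ prev ∣ ×
                                   SplitsCompletely prev A × FlagFrom A α As
  FlagFrom prev []      (_ ∷ _)  = Empty
  FlagFrom prev (_ ∷ _) []       = Empty

  GoodFlag : List ℕ → List (Subset n) → Set
  GoodFlag α As = FlagFrom ∅ α As

-- Generic functions.  A map f : E → {1,…,k} is stored as a vector
-- f : Vec (Fin k) n, the element i : Fin k standing for the positive
-- integer toℕ i + 1 (i.e. the variable x_{toℕ i + 1}).

weight : ∀ {k n} → Vec (Fin k) n → Subset n → ℕ
weight []      []          = 0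
weight (x ∷ f) (true ∷ B)  = suc (toℕ x) + weight f B
weight (x ∷ f) (false ∷ B) = weight f B

IsGeneric : ∀ {n k} → Matroid n → Vec (Fin k) n → Set
IsGeneric M f = ∃ λ B → IsBase M B ×
                  (∀ B′ → IsBase M B′ → B′ ≢ B → weight f B < weight f B′)

-- f contributes the monomial x_1^{β_1} ⋯ x_k^{β_k}
HasExponents : ∀ {n k} → Vec ℕ k → Vec (Fin k) n → Set
HasExponents {k = k} β f =
  (i : Fin k) → count (_≟ᶠ i) f ≡ Data.Vec.lookup β i

GenericWithExponents : ∀ {n k} → Matroid n → Vec ℕ k → Vec (Fin k) n → Set
GenericWithExponents M β f = IsGeneric M f × HasExponents β f

-- The composition obtained from a weak composition by deleting zeros.
-- The coefficient of x_1^{β_1}⋯x_k^{β_k} in M_α is 1 if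
-- compress β ≡ α and 0 otherwise.
compress : List ℕ → List ℕ
compress []          = []
compress (zero ∷ xs) = compress xs
compress (suc a ∷ xs) = suc a ∷ compress xs

-- "Exactly c elements of A satisfy P" (A has decidable equality in
-- all our uses): a duplicate-free list enumerating P, of length c.
HasCount : {A : Set} → (A → Set) → ℕ → Set
HasCount {A} P c = Σ (List A) λ xs →
  Unique xs × (∀ x → (x ∈ xs) ⇔ P x) × length xs ≡ c

-- Write L_j = {e : f(e) ≤ j}. Then f(B) = Σ_{j<k} |B ∖ L_j|, so by the rank inequality |B ∩ L_j| ≤ r(L_j)
-- a base minimises f exactly when it meets every L_j in a basis of L_j ("greedy" bases, which always
-- exist). Hence f is M-generic iff the greedy base is unique. A greedy base B meets L_{j+1} ∖ L_j in a
-- base of (M|L_{j+1})/L_j, and every base of that minor arises so (extend it greedily), so uniqueness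
-- holds iff each of these minors splits completely. Finally f ↦ (L_j)_j is a bijection from functions
-- with exponent vector β onto chains ∅ = L_0 ⊆ ⋯ ⊆ L_k = E with |L_j ∖ L_{j-1}| = β_j; deleting the
-- repetitions turns them into the flags of type compress β, and x^β occurs in M_α iff compress β = α.

module Submission where

open import Defs

open import Data.Nat
  using (ℕ; zero; suc; _+_; _≤_; _<_; _≟_; _≤′_; ≤′-reflexive; ≤′-step; _<ᵇ_; _∸_; z≤n; s≤s; _≤?_; _<?_)
open import Data.Nat.Properties
open import Data.Nat.Induction using (<-wellFounded)
open import Data.Bool using (Bool; true; false; not; _∧_) renaming (_≟_ to _≟ᵇ_)
open import Data.Bool.Properties using (T-≡)
open import Data.Fin using (Fin; zero; suc; toℕ) renaming (_≟_ to _≟ᶠ_)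
open import Data.Fin.Properties using (toℕ<n; toℕ-injective)
open import Data.Fin.Subset using (Subset; ⊤; _∪_; _∩_; _─_; _-_; ⁅_⁆; ∣_∣; _∈_; _∉_; _⊆_) renaming (⊥ to ∅)
open import Data.Fin.Subset.Properties
  using ( _∈?_; _⊆?_; anySubset?; ∈⊤; ∉⊥; ⊆-antisym; ⊆-min; ⊆-max; p⊂q⇒∣p∣<∣q∣; p⊆q⇒∣p∣≤∣q∣
        ; x∈p∪q⁺; x∈p∪q⁻; x∈p∩q⁺; x∈p∩q⁻; x∈p∧x∉q⇒x∈p─q; x∈⁅x⁆; x∈⁅y⁆⇒x≡y; ∣⁅x⁆∣≡1
        ; p∩q⊆p; p∩q⊆q; p⊆p∪q; q⊆p∪q; p─q⊆p; ∩-assoc; ∩-comm; ∪-comm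
        ; ∪-identityˡ; ∪-identityʳ; ∩-identityʳ; ∩-distribˡ-∪; ∩-distribʳ-∪ )
import Data.Fin.Properties as Fin
open import Data.Vec using (Vec; []; _∷_; here; there; lookup; tabulate; count; toList)
open import Data.Vec.Properties
  using (≡-dec; ∷-injective; []=⇒lookup; lookup⇒[]=; lookup-map; tabulate∘lookup; lookup∘tabulate; tabulate-cong)
open import Data.List using (List; []; _∷_; length; map; filter; allFin; cartesianProductWith)
open import Data.List.Properties using (length-map)
open import Data.List.Membership.Propositional using () renaming (_∈_ to _∈ₗ_)
open import Data.List.Membership.Propositional.Properties
  using (∈-filter⁺; ∈-filter⁻; ∈-map⁺; ∈-map⁻; ∈-allFin; ∈-cartesianProductWith⁺)
open import Data.List.Relation.Unary.All using (All; []; _∷_)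
import Data.List.Relation.Unary.All as All
import Data.List.Relation.Unary.All.Properties as Allₚ
open import Data.List.Relation.Unary.Any using (here)
open import Data.List.Relation.Unary.Unique.Propositional using (Unique; []; _∷_)
import Data.List.Relation.Unary.Unique.Propositional.Properties as Unique
open import Data.Product using (Σ; ∃; _×_; _,_; proj₁; proj₂)
open import Data.Sum using (_⊎_; inj₁; inj₂; [_,_]′)
open import Data.Empty using (⊥-elim)
open import Function using (_∘_; id; _⇔_; mk⇔; Equivalence)
open import Function.Properties.Equivalence using () renaming (trans to ⇔-trans)
import Induction.WellFounded as WF
import Relation.Binary.Construct.On as On
open import Relation.Nullary using (Dec; yes; no; ¬?; _×-dec_)
open import Relation.Nullary.Decidable using (decidable-stable; _→-dec_)
open import Relation.Binary.PropositionalEquality hiding ([_])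

private variable
  n : ℕ
  x : Fin n
  p q r : Subset n

measure-ind : {A : Set} (μ : A → ℕ) (P : A → Set) →
              (∀ a → (∀ b → μ b < μ a → P b) → P a) → ∀ a → P a
measure-ind μ P step = WF.All.wfRec (On.wellFounded μ <-wellFounded) _ P (λ a rec → step a (λ _ → rec))

m+n≡o+p∧o≤m⇒n≤p : ∀ {m n o p} → m + n ≡ o + p → o ≤ m → n ≤ p
m+n≡o+p∧o≤m⇒n≤p {m} {n} {o} {p} eq o≤m =
  +-cancelˡ-≤ o n p (≤-trans (+-monoˡ-≤ n o≤m) (≤-reflexive eq))

m+n≡o+p∧p≤n⇒m≤o : ∀ {m n o p} → m + n ≡ o + p → p ≤ n → m ≤ o
m+n≡o+p∧p≤n⇒m≤o {m} {n} {o} {p} eq =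
  m+n≡o+p∧o≤m⇒n≤p (trans (+-comm n m) (trans eq (+-comm o p)))

<ᵇ≡true : ∀ {m j} → m < j → (m <ᵇ j) ≡ true
<ᵇ≡true = Equivalence.to T-≡ ∘ <⇒<ᵇ

<ᵇ≡false : ∀ {m j} → j ≤ m → (m <ᵇ j) ≡ false
<ᵇ≡false {m} {j} j≤m with m <ᵇ j in m<ᵇj
... | false = refl
... | true = ⊥-elim (<⇒≱ (<ᵇ⇒< m j (Equivalence.from T-≡ m<ᵇj)) j≤m)

<ᵇ-suc : ∀ m j → m ≢ j → (m <ᵇ suc j) ≡ (m <ᵇ j)
<ᵇ-suc zero    zero    m≢j = ⊥-elim (m≢j refl)
<ᵇ-suc zero    (suc j) _   = refl
<ᵇ-suc (suc m) zero    _   = refl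
<ᵇ-suc (suc m) (suc j) m≢j = <ᵇ-suc m j (m≢j ∘ cong suc)

[_] : Bool → ℕ
[ true ]  = 1
[ false ] = 0

Σ< : ℕ → (ℕ → ℕ) → ℕ
Σ< zero    g = 0
Σ< (suc k) g = Σ< k g + g k

Σ<-cong : ∀ k {g h : ℕ → ℕ} → (∀ j → g j ≡ h j) → Σ< k g ≡ Σ< k h
Σ<-cong zero    g≗h = refl
Σ<-cong (suc k) g≗h = cong₂ _+_ (Σ<-cong k g≗h) (g≗h k)

Σ<-0 : ∀ k → Σ< k (λ _ → 0) ≡ 0
Σ<-0 zero    = refl
Σ<-0 (suc k) = trans (+-identityʳ _) (Σ<-0 k)

Σ<-+ : ∀ k (g h : ℕ → ℕ) → Σ< k (λ j → g j + h j) ≡ Σ< k g + Σ< k h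
Σ<-+ zero    g h = refl
Σ<-+ (suc k) g h = trans (cong (_+ (g k + h k)) (Σ<-+ k g h)) (interchange (Σ< k g) (Σ< k h) (g k) (h k))
  where open import Algebra.Properties.CommutativeSemigroup +-commutativeSemigroup using (interchange)

Σ<-mono-≤ : ∀ k {g h : ℕ → ℕ} → (∀ j → g j ≤ h j) → Σ< k g ≤ Σ< k h
Σ<-mono-≤ zero    g≤h = z≤n
Σ<-mono-≤ (suc k) g≤h = +-mono-≤ (Σ<-mono-≤ k g≤h) (g≤h k)

Σ<-≡-pointwise : ∀ k {g h : ℕ → ℕ} → (∀ j → g j ≤ h j) → Σ< k g ≡ Σ< k h → ∀ j → j < k → g j ≡ h j
Σ<-≡-pointwise (suc k) {g} {h} g≤h eq j j<1+k with m≤n⇒m<n∨m≡n (≤-pred j<1+k)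
... | inj₁ j<k = Σ<-≡-pointwise k g≤h (≤-antisym (Σ<-mono-≤ k g≤h) (m+n≡o+p∧p≤n⇒m≤o (sym eq) (g≤h k))) j j<k
... | inj₂ refl = ≤-antisym (g≤h j) (m+n≡o+p∧o≤m⇒n≤p (sym eq) (Σ<-mono-≤ j g≤h))

Σ<-[j≤m]≡k : ∀ k m → k ≤ m → Σ< k (λ j → [ not (m <ᵇ j) ]) ≡ k
Σ<-[j≤m]≡k zero    m _     = refl
Σ<-[j≤m]≡k (suc k) m 1+k≤m
  rewrite Σ<-[j≤m]≡k k m (≤-trans (n≤1+n k) 1+k≤m) | <ᵇ≡false {m} {k} (≤-trans (n≤1+n k) 1+k≤m) = +-comm k 1

Σ<-[j≤m]≡1+m : ∀ k m → m < k → Σ< k (λ j → [ not (m <ᵇ j) ]) ≡ suc m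
Σ<-[j≤m]≡1+m (suc k) m m<1+k with m≤n⇒m<n∨m≡n (≤-pred m<1+k)
... | inj₁ m<k rewrite Σ<-[j≤m]≡1+m k m m<k | <ᵇ≡true m<k = +-identityʳ (suc m)
... | inj₂ refl rewrite Σ<-[j≤m]≡k m m ≤-refl | <ᵇ≡false {m} {m} ≤-refl = +-comm m 1

-- Finite subsets

Disjoint : Subset n → Subset n → Set
Disjoint p q = ∀ {x} → x ∈ p → x ∉ q

x∈p─q⁻ : ∀ (p q : Subset n) → x ∈ p ─ q → x ∈ p × x ∉ q
x∈p─q⁻ (true ∷ p) (false ∷ q) here = here , λ ()
x∈p─q⁻ {x = zero} (false ∷ p) (false ∷ q) ()
x∈p─q⁻ {x = zero} (_ ∷ p)     (true ∷ q)  ()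
x∈p─q⁻ (_ ∷ p) (_ ∷ q) (there x∈p─q) with x∈p─q⁻ p q x∈p─q
... | x∈p , x∉q = there x∈p , λ { (there x∈q) → x∉q x∈q }

⊆-or-⊈ : (p q : Subset n) → p ⊆ q ⊎ ∃ λ x → x ∈ p × x ∉ q
⊆-or-⊈ p q with Fin.any? (λ x → x ∈? p ×-dec ¬? (x ∈? q))
... | yes witness = inj₂ witness
... | no ∄ = inj₁ λ {x} x∈p → decidable-stable (x ∈? q) (λ x∉q → ∄ (x , x∈p , x∉q))

⊆∧∣∣≤⇒≡ : p ⊆ q → ∣ q ∣ ≤ ∣ p ∣ → p ≡ q
⊆∧∣∣≤⇒≡ {p = p} {q} p⊆q ∣q∣≤∣p∣ with ⊆-or-⊈ q p
... | inj₁ q⊆p = ⊆-antisym p⊆q q⊆p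
... | inj₂ (x , x∈q , x∉p) = ⊥-elim (<⇒≱ (p⊂q⇒∣p∣<∣q∣ (p⊆q , x , x∈q , x∉p)) ∣q∣≤∣p∣)

∣p∣≡∣p∩q∣+∣p─q∣ : (p q : Subset n) → ∣ p ∣ ≡ ∣ p ∩ q ∣ + ∣ p ─ q ∣
∣p∣≡∣p∩q∣+∣p─q∣ []         []         = refl
∣p∣≡∣p∩q∣+∣p─q∣ (true ∷ p)  (true ∷ q)  = cong suc (∣p∣≡∣p∩q∣+∣p─q∣ p q)
∣p∣≡∣p∩q∣+∣p─q∣ (true ∷ p)  (false ∷ q) = trans (cong suc (∣p∣≡∣p∩q∣+∣p─q∣ p q)) (sym (+-suc _ _))
∣p∣≡∣p∩q∣+∣p─q∣ (false ∷ p) (true ∷ q)  = ∣p∣≡∣p∩q∣+∣p─q∣ p q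
∣p∣≡∣p∩q∣+∣p─q∣ (false ∷ p) (false ∷ q) = ∣p∣≡∣p∩q∣+∣p─q∣ p q

disjoint-∷ : ∀ {s t} → Disjoint (s ∷ p) (t ∷ q) → Disjoint p q
disjoint-∷ disj x∈p x∈q = disj (there x∈p) (there x∈q)

∣p∪q∣≡∣p∣+∣q∣ : (p q : Subset n) → Disjoint p q → ∣ p ∪ q ∣ ≡ ∣ p ∣ + ∣ q ∣
∣p∪q∣≡∣p∣+∣q∣ []          []          _    = refl
∣p∪q∣≡∣p∣+∣q∣ (true ∷ p)  (true ∷ q)  disj = ⊥-elim (disj here here)
∣p∪q∣≡∣p∣+∣q∣ (true ∷ p)  (false ∷ q) disj = cong suc (∣p∪q∣≡∣p∣+∣q∣ p q (disjoint-∷ disj))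
∣p∪q∣≡∣p∣+∣q∣ (false ∷ p) (true ∷ q)  disj =
  trans (cong suc (∣p∪q∣≡∣p∣+∣q∣ p q (disjoint-∷ disj))) (sym (+-suc _ _))
∣p∪q∣≡∣p∣+∣q∣ (false ∷ p) (false ∷ q) disj = ∣p∪q∣≡∣p∣+∣q∣ p q (disjoint-∷ disj)

p⊆q⇒p∩q≡p : p ⊆ q → p ∩ q ≡ p
p⊆q⇒p∩q≡p {p = p} {q} p⊆q = ⊆-antisym (p∩q⊆p p q) (λ x∈p → x∈p∩q⁺ (x∈p , p⊆q x∈p))

∩-restrict : q ⊆ r → (p ∩ r) ∩ q ≡ p ∩ q
∩-restrict {q = q} {r} {p} q⊆r =
  trans (∩-assoc p r q) (cong (p ∩_) (trans (∩-comm r q) (p⊆q⇒p∩q≡p q⊆r)))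

∪⁅⁆-⊆ : p ⊆ r → x ∈ r → p ∪ ⁅ x ⁆ ⊆ r
∪⁅⁆-⊆ {p = p} {x = x} p⊆r x∈r z∈ with x∈p∪q⁻ p ⁅ x ⁆ z∈
... | inj₁ z∈p = p⊆r z∈p
... | inj₂ z∈⁅x⁆ = subst (_∈ _) (sym (x∈⁅y⁆⇒x≡y x z∈⁅x⁆)) x∈r

disjoint⇒∩≡∅ : Disjoint p q → p ∩ q ≡ ∅
disjoint⇒∩≡∅ {p = p} {q} disjoint =
  ⊆-antisym (λ x∈ → let x∈p , x∈q = x∈p∩q⁻ p q x∈ in ⊥-elim (disjoint x∈p x∈q)) (⊆-min _)

∪-∩-disjointʳ : Disjoint q r → (p ∪ q) ∩ r ≡ p ∩ r
∪-∩-disjointʳ {q = q} {r} {p} disjoint = begin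
  (p ∪ q) ∩ r         ≡⟨ ∩-distribʳ-∪ r p q ⟩
  (p ∩ r) ∪ (q ∩ r)   ≡⟨ cong ((p ∩ r) ∪_) (disjoint⇒∩≡∅ disjoint) ⟩
  (p ∩ r) ∪ ∅         ≡⟨ ∪-identityʳ (p ∩ r) ⟩
  p ∩ r               ∎
  where open ≡-Reasoning

p─q∪q≡p : q ⊆ p → (p ─ q) ∪ q ≡ p
p─q∪q≡p {q = q} {p} q⊆p = ⊆-antisym (λ x∈ → [ proj₁ ∘ x∈p─q⁻ p q , q⊆p ]′ (x∈p∪q⁻ (p ─ q) q x∈)) covers
  where
  covers : p ⊆ (p ─ q) ∪ q
  covers {x} x∈p with x ∈? q
  ... | yes x∈q = q⊆p∪q (p ─ q) q x∈q
  ... | no x∉q  = p⊆p∪q q (x∈p∧x∉q⇒x∈p─q x∈p x∉q)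

∩-split : q ⊆ p → (r ∩ (p ─ q)) ∪ (r ∩ q) ≡ r ∩ p
∩-split {q = q} {p} {r} q⊆p = trans (sym (∩-distribˡ-∪ r (p ─ q) q)) (cong (r ∩_) (p─q∪q≡p q⊆p))

exch : Subset n → Fin n → Fin n → Subset n
exch B x y = (B - x) ∪ ⁅ y ⁆

module _ (B : Subset n) (x y : Fin n) where

  y∈exch : y ∈ exch B x y
  y∈exch = x∈p∪q⁺ (inj₂ (x∈⁅x⁆ y))

  ∈exch⁺ : ∀ {z} → z ∈ B → z ≢ x → z ∈ exch B x y
  ∈exch⁺ z∈B z≢x = x∈p∪q⁺ (inj₁ (x∈p∧x∉q⇒x∈p─q z∈B (z≢x ∘ x∈⁅y⁆⇒x≡y x)))

  ∈exch⁻ : ∀ {z} → z ∈ exch B x y → z ≡ y ⊎ (z ∈ B × z ≢ x)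
  ∈exch⁻ z∈exch with x∈p∪q⁻ (B - x) ⁅ y ⁆ z∈exch
  ... | inj₂ z∈⁅y⁆ = inj₁ (x∈⁅y⁆⇒x≡y y z∈⁅y⁆)
  ... | inj₁ z∈B-x with x∈p─q⁻ B ⁅ x ⁆ z∈B-x
  ...   | z∈B , z∉⁅x⁆ = inj₂ (z∈B , λ { refl → z∉⁅x⁆ (x∈⁅x⁆ x) })

  ∣exch∣ : x ∈ B → y ∉ B → ∣ exch B x y ∣ ≡ ∣ B ∣
  ∣exch∣ x∈B y∉B = begin
    ∣ (B - x) ∪ ⁅ y ⁆ ∣     ≡⟨ ∣p∪q∣≡∣p∣+∣q∣ (B - x) ⁅ y ⁆ y∉B-x ⟩
    ∣ B - x ∣ + ∣ ⁅ y ⁆ ∣   ≡⟨ cong (∣ B - x ∣ +_) (∣⁅x⁆∣≡1 y) ⟩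
    ∣ B - x ∣ + 1           ≡⟨ +-comm _ 1 ⟩
    1 + ∣ B - x ∣           ≡⟨ cong (_+ ∣ B - x ∣) (sym (trans (cong ∣_∣ B∩⁅x⁆≡⁅x⁆) (∣⁅x⁆∣≡1 x))) ⟩
    ∣ B ∩ ⁅ x ⁆ ∣ + ∣ B - x ∣ ≡⟨ sym (∣p∣≡∣p∩q∣+∣p─q∣ B ⁅ x ⁆) ⟩
    ∣ B ∣                   ∎
    where
    open ≡-Reasoning
    y∉B-x : Disjoint (B - x) ⁅ y ⁆
    y∉B-x z∈B-x z∈⁅y⁆ with x∈⁅y⁆⇒x≡y y z∈⁅y⁆
    ... | refl = y∉B (proj₁ (x∈p─q⁻ B ⁅ x ⁆ z∈B-x))
    B∩⁅x⁆≡⁅x⁆ : B ∩ ⁅ x ⁆ ≡ ⁅ x ⁆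
    B∩⁅x⁆≡⁅x⁆ = ⊆-antisym (p∩q⊆q B ⁅ x ⁆) λ z∈⁅x⁆ → x∈p∩q⁺ (subst (_∈ B) (sym (x∈⁅y⁆⇒x≡y x z∈⁅x⁆)) x∈B , z∈⁅x⁆)

  ∣exch─∣<∣─∣ : ∀ {C} → x ∈ B → x ∉ C → y ∈ C → ∣ exch B x y ─ C ∣ < ∣ B ─ C ∣
  ∣exch─∣<∣─∣ {C} x∈B x∉C y∈C =
    p⊂q⇒∣p∣<∣q∣ (shrinks , x , x∈p∧x∉q⇒x∈p─q x∈B x∉C , x∉exch ∘ proj₁ ∘ x∈p─q⁻ (exch B x y) C)
    where
    shrinks : exch B x y ─ C ⊆ B ─ C
    shrinks z∈ with x∈p─q⁻ (exch B x y) C z∈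
    ... | z∈exch , z∉C with ∈exch⁻ z∈exch
    ...   | inj₁ refl = ⊥-elim (z∉C y∈C)
    ...   | inj₂ (z∈B , _) = x∈p∧x∉q⇒x∈p─q z∈B z∉C
    x∉exch : x ∉ exch B x y
    x∉exch x∈exch with ∈exch⁻ x∈exch
    ... | inj₁ refl = x∉C y∈C
    ... | inj₂ (_ , x≢x) = x≢x refl

∣─∪⁅⁆∣<∣─∣ : ∀ {S I : Subset n} {e} → e ∈ S → e ∉ I → ∣ S ─ (I ∪ ⁅ e ⁆) ∣ < ∣ S ─ I ∣
∣─∪⁅⁆∣<∣─∣ {S = S} {I} {e} e∈S e∉I =
  p⊂q⇒∣p∣<∣q∣ (shrinks , e , x∈p∧x∉q⇒x∈p─q e∈S e∉I ,
               λ e∈ → proj₂ (x∈p─q⁻ S (I ∪ ⁅ e ⁆) e∈) (q⊆p∪q I ⁅ e ⁆ (x∈⁅x⁆ e)))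
  where
  shrinks : S ─ (I ∪ ⁅ e ⁆) ⊆ S ─ I
  shrinks z∈ with x∈p─q⁻ S (I ∪ ⁅ e ⁆) z∈
  ... | z∈S , z∉I∪e = x∈p∧x∉q⇒x∈p─q z∈S (z∉I∪e ∘ p⊆p∪q ⁅ e ⁆)

-- Matroids

module _ (M : Matroid n) where

  indep-⊆ : p ⊆ q → Indep M q → Indep M p
  indep-⊆ p⊆q (B , isB , q⊆B) = B , isB , q⊆B ∘ p⊆q

  base⇒indep : IsBase M p → Indep M p
  base⇒indep isB = _ , isB , id

  indep? : (I : Subset n) → Dec (Indep M I)
  indep? I = anySubset? (λ B → isBase? M B ×-dec (I ⊆? B))

  bases-⊆⇒≡ : IsBase M p → IsBase M q → p ⊆ q → p ≡ q
  bases-⊆⇒≡ {p} {q} isP isQ p⊆q with ⊆-or-⊈ q p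
  ... | inj₁ q⊆p = ⊆-antisym p⊆q q⊆p
  ... | inj₂ (x , x∈q , x∉p) with exchange M q p isQ isP x x∈q x∉p
  ...   | y , y∈p , y∉q , _ = ⊥-elim (y∉q (p⊆q y∈p))

  bases-equicardinal : IsBase M p → IsBase M q → ∣ p ∣ ≡ ∣ q ∣
  bases-equicardinal {p} {q} isP isQ =
    measure-ind (λ B → ∣ B ─ q ∣) (λ B → IsBase M B → ∣ B ∣ ≡ ∣ q ∣) step p isP
    where
    step : ∀ B → (∀ B′ → ∣ B′ ─ q ∣ < ∣ B ─ q ∣ → IsBase M B′ → ∣ B′ ∣ ≡ ∣ q ∣) →
           IsBase M B → ∣ B ∣ ≡ ∣ q ∣
    step B ih isB with ⊆-or-⊈ B q
    ... | inj₁ B⊆q = cong ∣_∣ (bases-⊆⇒≡ isB isQ B⊆q)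
    ... | inj₂ (x , x∈B , x∉q) with exchange M B q isB isQ x x∈B x∉q
    ...   | y , y∈q , y∉B , isB′ =
      trans (sym (∣exch∣ B x y x∈B y∉B)) (ih _ (∣exch─∣<∣─∣ B x y x∈B x∉q y∈q) isB′)

  bases-split-equicardinal : ∀ S → IsBase M p → IsBase M q →
                             ∣ p ∩ S ∣ + ∣ p ─ S ∣ ≡ ∣ q ∩ S ∣ + ∣ q ─ S ∣
  bases-split-equicardinal {p} {q} S isP isQ =
    trans (sym (∣p∣≡∣p∩q∣+∣p─q∣ p S)) (trans (bases-equicardinal isP isQ) (∣p∣≡∣p∩q∣+∣p─q∣ q S))

  basis-∩-maximal : ∀ {S J K} → IsBasisOf M S J → J ⊆ K → Indep M K → K ∩ S ≡ J
  basis-∩-maximal {S} {J} {K} (J⊆S , _ , maximal) J⊆K indepK =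
    maximal (K ∩ S) (λ x∈J → x∈p∩q⁺ (J⊆K x∈J , J⊆S x∈J)) (p∩q⊆q K S) (indep-⊆ (p∩q⊆p K S) indepK)

  -- Induction on ∣ B₀ ─ B ∣ over bases B₀ ⊇ J. An element of B₀ ─ B outside S is exchanged for some
  -- w ∈ B, and w ∉ S by maximality of J. Once no such element is left, B₀ ─ S ⊆ B ─ S, and counting
  -- gives ∣ B ∩ S ∣ ≤ ∣ B₀ ∩ S ∣ = ∣ J ∣.
  base-∩-∣∣≤basis : ∀ {S J B} → IsBasisOf M S J → IsBase M B → ∣ B ∩ S ∣ ≤ ∣ J ∣
  base-∩-∣∣≤basis {S} {J} {B} basisJ@(J⊆S , (BJ , isBJ , J⊆BJ) , maximal) isB =
    measure-ind (λ B₀ → ∣ B₀ ─ B ∣) P step BJ isBJ J⊆BJ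
    where
    P : Subset n → Set
    P B₀ = IsBase M B₀ → J ⊆ B₀ → ∣ B ∩ S ∣ ≤ ∣ J ∣
    J⊆exch : ∀ {B₀ z w} → J ⊆ B₀ → z ∉ S → J ⊆ exch B₀ z w
    J⊆exch J⊆B₀ z∉S x∈J = ∈exch⁺ _ _ _ (J⊆B₀ x∈J) λ { refl → z∉S (J⊆S x∈J) }
    step : ∀ B₀ → (∀ B₁ → ∣ B₁ ─ B ∣ < ∣ B₀ ─ B ∣ → P B₁) → P B₀
    step B₀ ih isB₀ J⊆B₀ with Fin.any? (λ z → z ∈? B₀ ×-dec ¬? (z ∈? B) ×-dec ¬? (z ∈? S))
    ... | no ∄ = begin
      ∣ B ∩ S ∣   ≤⟨ m+n≡o+p∧p≤n⇒m≤o (sym split) outside-≤ ⟩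
      ∣ B₀ ∩ S ∣  ≡⟨ cong ∣_∣ (basis-∩-maximal basisJ J⊆B₀ (base⇒indep isB₀)) ⟩
      ∣ J ∣       ∎
      where
      open ≤-Reasoning
      split : ∣ B₀ ∩ S ∣ + ∣ B₀ ─ S ∣ ≡ ∣ B ∩ S ∣ + ∣ B ─ S ∣
      split = bases-split-equicardinal S isB₀ isB
      outside-≤ : ∣ B₀ ─ S ∣ ≤ ∣ B ─ S ∣
      outside-≤ = p⊆q⇒∣p∣≤∣q∣ λ {z} z∈ → let z∈B₀ , z∉S = x∈p─q⁻ B₀ S z∈ in
        x∈p∧x∉q⇒x∈p─q (decidable-stable (z ∈? B) (λ z∉B → ∄ (z , z∈B₀ , z∉B , z∉S))) z∉S
    ... | yes (z , z∈B₀ , z∉B , z∉S) with exchange M B₀ B isB₀ isB z z∈B₀ z∉B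
    ...   | w , w∈B , w∉B₀ , isB₁ with w ∈? S
    ...     | no w∉S = ih (exch B₀ z w) (∣exch─∣<∣─∣ B₀ z w z∈B₀ z∉B w∈B) isB₁ (J⊆exch J⊆B₀ z∉S)
    ...     | yes w∈S = ⊥-elim (w∉B₀ (J⊆B₀ (subst (w ∈_) J+w≡J (q⊆p∪q J ⁅ w ⁆ (x∈⁅x⁆ w)))))
      where
      J+w≡J : J ∪ ⁅ w ⁆ ≡ J
      J+w≡J = maximal (J ∪ ⁅ w ⁆) (p⊆p∪q ⁅ w ⁆) (∪⁅⁆-⊆ J⊆S w∈S)
                (indep-⊆ (∪⁅⁆-⊆ (J⊆exch J⊆B₀ z∉S) (y∈exch B₀ z w)) (base⇒indep isB₁))

  indep-∣∣≤basis : ∀ {S J I} → IsBasisOf M S J → Indep M I → I ⊆ S → ∣ I ∣ ≤ ∣ J ∣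
  indep-∣∣≤basis {S} {J} {I} basisJ (B , isB , I⊆B) I⊆S =
    ≤-trans (p⊆q⇒∣p∣≤∣q∣ λ x∈I → x∈p∩q⁺ (I⊆B x∈I , I⊆S x∈I)) (base-∩-∣∣≤basis basisJ isB)

  indep-∅ : Indep M ∅
  indep-∅ = indep-⊆ (⊆-min _) (base⇒indep (proj₂ (base-exists M)))

  basis-extend : ∀ {S I} → Indep M I → I ⊆ S → ∃ λ J → IsBasisOf M S J × I ⊆ J
  basis-extend {S} {I} = measure-ind (λ I → ∣ S ─ I ∣) P step I
    where
    P : Subset n → Set
    P I = Indep M I → I ⊆ S → ∃ λ J → IsBasisOf M S J × I ⊆ J
    step : ∀ I → (∀ I′ → ∣ S ─ I′ ∣ < ∣ S ─ I ∣ → P I′) → P I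
    step I ih indepI I⊆S with Fin.any? (λ e → e ∈? S ×-dec ¬? (e ∈? I) ×-dec indep? (I ∪ ⁅ e ⁆))
    ... | yes (e , e∈S , e∉I , indepI+e) with ih (I ∪ ⁅ e ⁆) (∣─∪⁅⁆∣<∣─∣ e∈S e∉I) indepI+e (∪⁅⁆-⊆ I⊆S e∈S)
    ...   | J , basisJ , I+e⊆J = J , basisJ , I+e⊆J ∘ p⊆p∪q ⁅ e ⁆
    step I ih indepI I⊆S | no ∄ = I , (I⊆S , indepI , maximal) , id
      where
      maximal : ∀ K → I ⊆ K → K ⊆ S → Indep M K → K ≡ I
      maximal K I⊆K K⊆S indepK with ⊆-or-⊈ K I
      ... | inj₁ K⊆I = ⊆-antisym K⊆I I⊆K
      ... | inj₂ (e , e∈K , e∉I) = ⊥-elim (∄ (e , K⊆S e∈K , e∉I , indep-⊆ (∪⁅⁆-⊆ I⊆K e∈K) indepK))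

  basis-exists : ∀ S → ∃ (IsBasisOf M S)
  basis-exists S = let J , basisJ , _ = basis-extend indep-∅ (⊆-min S) in J , basisJ

  indep-∣∣≥basis⇒basis : ∀ {S J I} → IsBasisOf M S J → Indep M I → I ⊆ S → ∣ J ∣ ≤ ∣ I ∣ →
                         IsBasisOf M S I
  indep-∣∣≥basis⇒basis basisJ indepI I⊆S ∣J∣≤∣I∣ = I⊆S , indepI , λ K I⊆K K⊆S indepK →
    sym (⊆∧∣∣≤⇒≡ I⊆K (≤-trans (indep-∣∣≤basis basisJ indepK K⊆S) ∣J∣≤∣I∣))

  bases-of-equicardinal : ∀ {S I J} → IsBasisOf M S I → IsBasisOf M S J → ∣ I ∣ ≡ ∣ J ∣
  bases-of-equicardinal basisI@(I⊆S , indepI , _) basisJ@(J⊆S , indepJ , _) =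
    ≤-antisym (indep-∣∣≤basis basisJ indepI I⊆S) (indep-∣∣≤basis basisI indepJ J⊆S)

  base⇒basis-⊤ : IsBase M p → IsBasisOf M ⊤ p
  base⇒basis-⊤ {p} isP = ⊆-max p , base⇒indep isP , maximal
    where
    maximal : ∀ K → p ⊆ K → K ⊆ ⊤ → Indep M K → K ≡ p
    maximal K p⊆K _ (B , isB , K⊆B) with bases-⊆⇒≡ isP isB (K⊆B ∘ p⊆K)
    ... | refl = ⊆-antisym K⊆B p⊆K

  basis-⊤⇒base : IsBasisOf M ⊤ p → IsBase M p
  basis-⊤⇒base (_ , (B , isB , p⊆B) , maximal) =
    subst (IsBase M) (maximal B p⊆B (⊆-max B) (base⇒indep isB)) isB

  -- A basis K of X ∪ I ∪ I′ through I′ meets C in I′, so K ⊆ X ∪ I′; comparing sizes, K = X ∪ I′.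
  minorBase-basis-irrelevant : ∀ {C A X I I′} → C ⊆ A → Disjoint X C →
    IsBasisOf M C I → IsBasisOf M C I′ → IsBasisOf M A (X ∪ I) → IsBasisOf M A (X ∪ I′)
  minorBase-basis-irrelevant {C} {A} {X} {I} {I′} C⊆A X#C
    basisI@(I⊆C , _) basisI′@(I′⊆C , indepI′ , _) basisXI@(XI⊆A , indepXI , _)
    with basis-extend {(X ∪ I) ∪ I′} indepI′ (q⊆p∪q (X ∪ I) I′)
  ... | K , basisK@(K⊆S , indepK , _) , I′⊆K =
    indep-∣∣≥basis⇒basis basisXI (subst (Indep M) K≡XI′ indepK) XI′⊆A (≤-reflexive (sym ∣XI′∣≡∣XI∣))
    where
    ∣XI′∣≡∣XI∣ : ∣ X ∪ I′ ∣ ≡ ∣ X ∪ I ∣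
    ∣XI′∣≡∣XI∣ = begin
      ∣ X ∪ I′ ∣      ≡⟨ ∣p∪q∣≡∣p∣+∣q∣ X I′ (λ x∈X → X#C x∈X ∘ I′⊆C) ⟩
      ∣ X ∣ + ∣ I′ ∣  ≡⟨ cong (∣ X ∣ +_) (bases-of-equicardinal basisI′ basisI) ⟩
      ∣ X ∣ + ∣ I ∣   ≡⟨ sym (∣p∪q∣≡∣p∣+∣q∣ X I (λ x∈X → X#C x∈X ∘ I⊆C)) ⟩
      ∣ X ∪ I ∣       ∎
      where open ≡-Reasoning
    XI′⊆A : X ∪ I′ ⊆ A
    XI′⊆A x∈ with x∈p∪q⁻ X I′ x∈
    ... | inj₁ x∈X = XI⊆A (p⊆p∪q I x∈X)
    ... | inj₂ x∈I′ = C⊆A (I′⊆C x∈I′)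
    K⊆XI′ : K ⊆ X ∪ I′
    K⊆XI′ {x} x∈K with x∈p∪q⁻ (X ∪ I) I′ (K⊆S x∈K)
    ... | inj₂ x∈I′ = q⊆p∪q X I′ x∈I′
    ... | inj₁ x∈XI with x∈p∪q⁻ X I x∈XI
    ...   | inj₁ x∈X = p⊆p∪q I′ x∈X
    ...   | inj₂ x∈I = q⊆p∪q X I′ (subst (x ∈_) (basis-∩-maximal basisI′ I′⊆K indepK) (x∈p∩q⁺ (x∈K , I⊆C x∈I)))
    K≡XI′ : K ≡ X ∪ I′
    K≡XI′ = ⊆∧∣∣≤⇒≡ K⊆XI′ (begin
      ∣ X ∪ I′ ∣ ≡⟨ ∣XI′∣≡∣XI∣ ⟩
      ∣ X ∪ I ∣  ≤⟨ indep-∣∣≤basis basisK indepXI (p⊆p∪q I′) ⟩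
      ∣ K ∣      ∎)
      where open ≤-Reasoning

  splitsCompletely-refl : ∀ C → SplitsCompletely M C C
  splitsCompletely-refl C = ∅ , (⊆-min _ , I , basisI , subst (IsBasisOf M C) (sym (∪-identityˡ I)) basisI) ,
                            λ Y (Y⊆C─C , _) → ⊆-antisym (λ y∈Y → ⊥-elim (C─C-empty (Y⊆C─C y∈Y))) (⊆-min Y)
    where
    I = proj₁ (basis-exists C)
    basisI = proj₂ (basis-exists C)
    C─C-empty : ∀ {x} → x ∉ C ─ C
    C─C-empty x∈ = let x∈C , x∉C = x∈p─q⁻ C C x∈ in x∉C x∈C

-- Level sets of a function E → {1,…,k}

module _ {k : ℕ} where

  -- With the paper's values f(e) = toℕ (f e) + 1, level f j is {e : f(e) ≤ j}.
  level : Vec (Fin k) n → ℕ → Subset n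
  level f j = Data.Vec.map (λ v → toℕ v <ᵇ j) f

  ∈-level⁺ : ∀ (f : Vec (Fin k) n) {j e} → toℕ (lookup f e) < j → e ∈ level f j
  ∈-level⁺ f {j} {e} fe<j = lookup⇒[]= e (level f j) (trans (lookup-map e _ f) (<ᵇ≡true fe<j))

  ∈-level⁻ : ∀ (f : Vec (Fin k) n) {j e} → e ∈ level f j → toℕ (lookup f e) < j
  ∈-level⁻ f {j} {e} e∈ =
    <ᵇ⇒< _ j (Equivalence.from T-≡ (trans (sym (lookup-map e _ f)) ([]=⇒lookup e∈)))

  level-mono : ∀ (f : Vec (Fin k) n) {i j} → i ≤ j → level f i ⊆ level f j
  level-mono f i≤j e∈ = ∈-level⁺ f (≤-trans (∈-level⁻ f e∈) i≤j)

  level-0 : ∀ (f : Vec (Fin k) n) → level f 0 ≡ ∅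
  level-0 f = ⊆-antisym (λ e∈ → ⊥-elim (<⇒≱ (∈-level⁻ f e∈) z≤n)) (⊆-min _)

  level-top : ∀ (f : Vec (Fin k) n) {j} → k ≤ j → level f j ≡ ⊤
  level-top f k≤j = ⊆-antisym (⊆-max _) (λ {e} _ → ∈-level⁺ f (≤-trans (toℕ<n (lookup f e)) k≤j))

  level-size : ∀ (f : Vec (Fin k) n) (i : Fin k) →
               ∣ level f (suc (toℕ i)) ∣ ≡ count (_≟ᶠ i) f + ∣ level f (toℕ i) ∣
  level-size []      i = refl
  level-size (v ∷ f) i with v ≟ᶠ i
  ... | yes refl rewrite <ᵇ≡true (n<1+n (toℕ i)) | <ᵇ≡false {toℕ i} ≤-refl = cong suc (level-size f i)
  ... | no v≢i rewrite <ᵇ-suc (toℕ v) (toℕ i) (v≢i ∘ toℕ-injective) with toℕ v <ᵇ toℕ i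
  ...   | true  = trans (cong suc (level-size f i)) (sym (+-suc _ _))
  ...   | false = level-size f i

  level-injective : ∀ (f g : Vec (Fin k) n) → (∀ j → level f j ≡ level g j) → f ≡ g
  level-injective f g f≗g = begin
    f                  ≡⟨ sym (tabulate∘lookup f) ⟩
    tabulate (lookup f) ≡⟨ tabulate-cong (λ e → toℕ-injective (≤-antisym (below g f (sym ∘ f≗g) e)
                                                                         (below f g f≗g e))) ⟩
    tabulate (lookup g) ≡⟨ tabulate∘lookup g ⟩
    g                  ∎
    where
    open ≡-Reasoning
    below : ∀ f g → (∀ j → level f j ≡ level g j) → ∀ e → toℕ (lookup g e) ≤ toℕ (lookup f e)
    below f g f≗g e = ≤-pred (∈-level⁻ g (subst (e ∈_) (f≗g (suc (toℕ (lookup f e)))) (∈-level⁺ f ≤-refl)))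

  ∣∷─∷∣ : ∀ b c (p q : Subset n) → ∣ (b ∷ p) ─ (c ∷ q) ∣ ≡ [ b ∧ not c ] + ∣ p ─ q ∣
  ∣∷─∷∣ true  true  p q = refl
  ∣∷─∷∣ true  false p q = refl
  ∣∷─∷∣ false true  p q = refl
  ∣∷─∷∣ false false p q = refl

  -- Layer-cake decomposition: e ∈ B lies outside exactly the levels j ≤ toℕ (f e), as many as its weight.
  weight≡Σ<∣─level∣ : ∀ (f : Vec (Fin k) n) B → weight f B ≡ Σ< k (λ j → ∣ B ─ level f j ∣)
  weight≡Σ<∣─level∣ []      []      = sym (Σ<-0 k)
  weight≡Σ<∣─level∣ (v ∷ f) (b ∷ B) = begin
    weight (v ∷ f) (b ∷ B)
      ≡⟨ head b ⟩
    Σ< k (λ j → [ b ∧ not (toℕ v <ᵇ j) ]) + Σ< k (λ j → ∣ B ─ level f j ∣)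
      ≡⟨ sym (Σ<-+ k _ _) ⟩
    Σ< k (λ j → [ b ∧ not (toℕ v <ᵇ j) ] + ∣ B ─ level f j ∣)
      ≡⟨ Σ<-cong k (λ j → sym (∣∷─∷∣ b _ B (level f j))) ⟩
    Σ< k (λ j → ∣ (b ∷ B) ─ level (v ∷ f) j ∣)
      ∎
    where
    open ≡-Reasoning
    head : ∀ b → weight (v ∷ f) (b ∷ B) ≡
                 Σ< k (λ j → [ b ∧ not (toℕ v <ᵇ j) ]) + Σ< k (λ j → ∣ B ─ level f j ∣)
    head true  = cong₂ _+_ (sym (Σ<-[j≤m]≡1+m k (toℕ v) (toℕ<n v))) (weight≡Σ<∣─level∣ f B)
    head false = cong₂ _+_ (sym (Σ<-0 k)) (weight≡Σ<∣─level∣ f B)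

-- Greedy bases

ChainSplits : Matroid n → (ℕ → Subset n) → Set
ChainSplits M W = ∀ j → SplitsCompletely M (W j) (W (suc j))

module Greedy (M : Matroid n) {k : ℕ} (f : Vec (Fin k) n) where

  IsGreedy : Subset n → Set
  IsGreedy B = ∀ j → IsBasisOf M (level f j) (B ∩ level f j)

  GreedyUpTo : ℕ → Subset n → Set
  GreedyUpTo m J = ∀ i → i ≤ m → IsBasisOf M (level f i) (J ∩ level f i)

  base-∩-top-basis : ∀ {B j} → IsBase M B → k ≤ j → IsBasisOf M (level f j) (B ∩ level f j)
  base-∩-top-basis {B} isB k≤j rewrite level-top f k≤j | ∩-identityʳ B = base⇒basis-⊤ M isB

  greedy-∣─level∣-≤ : ∀ {B B′} → IsBase M B → IsGreedy B → IsBase M B′ →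
                      ∀ j → ∣ B ─ level f j ∣ ≤ ∣ B′ ─ level f j ∣
  greedy-∣─level∣-≤ isB greedyB isB′ j =
    m+n≡o+p∧o≤m⇒n≤p (bases-split-equicardinal M (level f j) isB isB′) (base-∩-∣∣≤basis M (greedyB j) isB′)

  greedy-weight-≤ : ∀ {B B′} → IsBase M B → IsGreedy B → IsBase M B′ → weight f B ≤ weight f B′
  greedy-weight-≤ {B} {B′} isB greedyB isB′ =
    subst₂ _≤_ (sym (weight≡Σ<∣─level∣ f B)) (sym (weight≡Σ<∣─level∣ f B′))
      (Σ<-mono-≤ k (greedy-∣─level∣-≤ isB greedyB isB′))

  greedy-weight-≡⇒greedy : ∀ {B B′} → IsBase M B → IsGreedy B → IsBase M B′ →
                           weight f B ≡ weight f B′ → IsGreedy B′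
  greedy-weight-≡⇒greedy {B} {B′} isB greedyB isB′ eq j with k ≤? j
  ... | yes k≤j = base-∩-top-basis isB′ k≤j
  ... | no k≰j = indep-∣∣≥basis⇒basis M (greedyB j) (indep-⊆ M (p∩q⊆p B′ L) (base⇒indep M isB′))
                   (p∩q⊆q B′ L) (≤-reflexive inside-≡)
    where
    L = level f j
    outside-≡ : ∣ B ─ L ∣ ≡ ∣ B′ ─ L ∣
    outside-≡ = Σ<-≡-pointwise k (greedy-∣─level∣-≤ isB greedyB isB′)
      (trans (sym (weight≡Σ<∣─level∣ f B)) (trans eq (weight≡Σ<∣─level∣ f B′))) j (≰⇒> k≰j)
    inside-≡ : ∣ B ∩ L ∣ ≡ ∣ B′ ∩ L ∣
    inside-≡ = +-cancelʳ-≡ _ _ _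
      (trans (bases-split-equicardinal M L isB isB′) (cong (∣ B′ ∩ L ∣ +_) (sym outside-≡)))

  greedyUpTo⇒basis : ∀ {m J} → J ⊆ level f m → GreedyUpTo m J → IsBasisOf M (level f m) J
  greedyUpTo⇒basis J⊆Lm upToJ = subst (IsBasisOf M _) (p⊆q⇒p∩q≡p J⊆Lm) (upToJ _ ≤-refl)

  greedyUpTo-top : ∀ {m J} → k ≤ m → J ⊆ level f m → GreedyUpTo m J → IsBase M J × IsGreedy J
  greedyUpTo-top {m} {J} k≤m J⊆Lm upToJ =
    basis-⊤⇒base M (subst (λ S → IsBasisOf M S J) (level-top f k≤m) (greedyUpTo⇒basis J⊆Lm upToJ)) , greedyJ
    where
    greedyJ : IsGreedy J
    greedyJ i with i ≤? m
    ... | yes i≤m = upToJ i i≤m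
    ... | no i≰m = subst (λ S → IsBasisOf M S (J ∩ S))
                     (trans (level-top f k≤m) (sym (level-top f (≤-trans k≤m (<⇒≤ (≰⇒> i≰m))))))
                     (upToJ m ≤-refl)

  greedyUpTo-suc : ∀ {m J} → J ⊆ level f m → GreedyUpTo m J →
                   ∃ λ J′ → J′ ⊆ level f (suc m) × GreedyUpTo (suc m) J′ × J′ ∩ level f m ≡ J
  greedyUpTo-suc {m} {J} J⊆Lm upToJ with greedyUpTo⇒basis J⊆Lm upToJ
  ... | basisJ@(_ , indepJ , _) with basis-extend M indepJ (level-mono f (n≤1+n m) ∘ J⊆Lm)
  ...   | J′ , basisJ′@(J′⊆L1+m , indepJ′ , _) , J⊆J′ = J′ , J′⊆L1+m , upToJ′ , J′∩Lm≡J
    where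
    J′∩Lm≡J : J′ ∩ level f m ≡ J
    J′∩Lm≡J = basis-∩-maximal M basisJ J⊆J′ indepJ′
    upToJ′ : GreedyUpTo (suc m) J′
    upToJ′ i i≤1+m with m≤n⇒m<n∨m≡n i≤1+m
    ... | inj₂ refl = subst (IsBasisOf M (level f i)) (sym (p⊆q⇒p∩q≡p J′⊆L1+m)) basisJ′
    ... | inj₁ i<1+m = subst (IsBasisOf M (level f i))
                             (trans (cong (_∩ level f i) (sym J′∩Lm≡J)) (∩-restrict (level-mono f (≤-pred i<1+m))))
                             (upToJ i (≤-pred i<1+m))

  greedy-extend : ∀ m J → J ⊆ level f m → GreedyUpTo m J →
                  ∃ λ B → IsBase M B × IsGreedy B × B ∩ level f m ≡ J
  greedy-extend = measure-ind (k ∸_) P step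
    where
    P : ℕ → Set
    P m = ∀ J → J ⊆ level f m → GreedyUpTo m J → ∃ λ B → IsBase M B × IsGreedy B × B ∩ level f m ≡ J
    step : ∀ m → (∀ m′ → k ∸ m′ < k ∸ m → P m′) → P m
    step m ih J J⊆Lm upToJ with k ≤? m
    ... | yes k≤m = let isJ , greedyJ = greedyUpTo-top k≤m J⊆Lm upToJ in J , isJ , greedyJ , p⊆q⇒p∩q≡p J⊆Lm
    ... | no k≰m with greedyUpTo-suc J⊆Lm upToJ
    ...   | J′ , J′⊆L1+m , upToJ′ , J′∩Lm≡J with ih (suc m) (∸-monoʳ-< (n<1+n m) (≰⇒> k≰m)) J′ J′⊆L1+m upToJ′
    ...     | B , isB , greedyB , B∩L1+m≡J′ = B , isB , greedyB , (begin
      B ∩ level f m                     ≡⟨ sym (∩-restrict (level-mono f (n≤1+n m))) ⟩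
      (B ∩ level f (suc m)) ∩ level f m ≡⟨ cong (_∩ level f m) B∩L1+m≡J′ ⟩
      J′ ∩ level f m                    ≡⟨ J′∩Lm≡J ⟩
      J                                 ∎)
      where open ≡-Reasoning

  greedy-exists : ∃ λ B → IsBase M B × IsGreedy B
  greedy-exists with basis-exists M (level f 0)
  ... | J , basisJ@(J⊆L0 , _) with greedy-extend 0 J J⊆L0 upToJ
    where
    upToJ : GreedyUpTo 0 J
    upToJ .0 z≤n = subst (IsBasisOf M (level f 0)) (sym (p⊆q⇒p∩q≡p J⊆L0)) basisJ
  ...   | B , isB , greedyB , _ = B , isB , greedyB

  UniqueGreedyBase : Set
  UniqueGreedyBase = ∃ λ B → IsBase M B × IsGreedy B × ∀ B′ → IsBase M B′ → IsGreedy B′ → B′ ≡ B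

  generic⇔uniqueGreedyBase : IsGeneric M f ⇔ UniqueGreedyBase
  generic⇔uniqueGreedyBase = mk⇔ generic⇒unique unique⇒generic
    where
    generic⇒unique : IsGeneric M f → UniqueGreedyBase
    generic⇒unique (B₀ , isB₀ , B₀-strict-min) =
      let G , isG , greedyG = greedy-exists in
      B₀ , isB₀ , subst IsGreedy (greedy⇒≡B₀ isG greedyG) greedyG ,
      λ B′ isB′ greedyB′ → greedy⇒≡B₀ isB′ greedyB′
      where
      greedy⇒≡B₀ : ∀ {B} → IsBase M B → IsGreedy B → B ≡ B₀
      greedy⇒≡B₀ {B} isB greedyB with ≡-dec _≟ᵇ_ B B₀
      ... | yes B≡B₀ = B≡B₀
      ... | no B≢B₀ = ⊥-elim (<⇒≱ (B₀-strict-min B isB B≢B₀) (greedy-weight-≤ isB greedyB isB₀))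
    unique⇒generic : UniqueGreedyBase → IsGeneric M f
    unique⇒generic (B , isB , greedyB , unique) = B , isB , λ B′ isB′ B′≢B →
      ≤∧≢⇒< (greedy-weight-≤ isB greedyB isB′) (B′≢B ∘ unique B′ isB′ ∘ greedy-weight-≡⇒greedy isB greedyB isB′)

  greedy-minorBase : ∀ {B} → IsGreedy B → ∀ j →
                     IsMinorBase M (level f j) (level f (suc j)) (B ∩ (level f (suc j) ─ level f j))
  greedy-minorBase {B} greedyB j = p∩q⊆q B _ , B ∩ level f j , greedyB j ,
    subst (IsBasisOf M (level f (suc j))) (sym (∩-split (level-mono f (n≤1+n j)))) (greedyB (suc j))

  minorBase-extends : ∀ {B j Y} → IsGreedy B → IsMinorBase M (level f j) (level f (suc j)) Y →
                      ∃ λ B′ → IsBase M B′ × IsGreedy B′ × B′ ∩ level f (suc j) ≡ Y ∪ (B ∩ level f j)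
  minorBase-extends {B} {j} {Y} greedyB (Y⊆A─C , I , basisI , basisYI) =
    greedy-extend (suc j) (Y ∪ (B ∩ C)) (proj₁ basisYZ) upToYZ
    where
    C = level f j
    A = level f (suc j)
    Y#C : Disjoint Y C
    Y#C y∈Y = proj₂ (x∈p─q⁻ A C (Y⊆A─C y∈Y))
    basisYZ : IsBasisOf M A (Y ∪ (B ∩ C))
    basisYZ = minorBase-basis-irrelevant M (level-mono f (n≤1+n j)) Y#C basisI (greedyB j) basisYI
    upToYZ : GreedyUpTo (suc j) (Y ∪ (B ∩ C))
    upToYZ i i≤1+j with m≤n⇒m<n∨m≡n i≤1+j
    ... | inj₂ refl = subst (IsBasisOf M A) (sym (p⊆q⇒p∩q≡p (proj₁ basisYZ))) basisYZ
    ... | inj₁ i<1+j = subst (IsBasisOf M (level f i)) (sym (begin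
          (Y ∪ (B ∩ C)) ∩ level f i ≡⟨ cong (_∩ level f i) (∪-comm Y (B ∩ C)) ⟩
          ((B ∩ C) ∪ Y) ∩ level f i ≡⟨ ∪-∩-disjointʳ (λ y∈Y → Y#C y∈Y ∘ Li⊆C) ⟩
          (B ∩ C) ∩ level f i       ≡⟨ ∩-restrict Li⊆C ⟩
          B ∩ level f i             ∎)) (greedyB i)
      where
      open ≡-Reasoning
      Li⊆C = level-mono f (≤-pred i<1+j)

  uniqueGreedyBase⇒chainSplits : UniqueGreedyBase → ChainSplits M (level f)
  uniqueGreedyBase⇒chainSplits (B , isB , greedyB , unique) j =
    B ∩ (A ─ C) , greedy-minorBase greedyB j , minorBase-unique
    where
    C = level f j
    A = level f (suc j)
    minorBase-unique : ∀ Y → IsMinorBase M C A Y → Y ≡ B ∩ (A ─ C)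
    minorBase-unique Y minorY@(Y⊆A─C , _) with minorBase-extends greedyB minorY
    ... | B′ , isB′ , greedyB′ , B′∩A≡Y∪B∩C = begin
      Y                           ≡⟨ sym (p⊆q⇒p∩q≡p Y⊆A─C) ⟩
      Y ∩ (A ─ C)                 ≡⟨ sym (∪-∩-disjointʳ B∩C#A─C) ⟩
      (Y ∪ (B ∩ C)) ∩ (A ─ C)     ≡⟨ cong (_∩ (A ─ C)) (sym B′∩A≡Y∪B∩C) ⟩
      (B′ ∩ A) ∩ (A ─ C)          ≡⟨ ∩-restrict (p─q⊆p A C) ⟩
      B′ ∩ (A ─ C)                ≡⟨ cong (_∩ (A ─ C)) (unique B′ isB′ greedyB′) ⟩
      B ∩ (A ─ C)                 ∎
      where
      open ≡-Reasoning
      B∩C#A─C : Disjoint (B ∩ C) (A ─ C)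
      B∩C#A─C z∈B∩C z∈A─C = proj₂ (x∈p─q⁻ A C z∈A─C) (p∩q⊆q B C z∈B∩C)

  chainSplits⇒uniqueGreedyBase : ChainSplits M (level f) → UniqueGreedyBase
  chainSplits⇒uniqueGreedyBase splits = let B , isB , greedyB = greedy-exists in
    B , isB , greedyB , λ B′ _ greedyB′ → ⊆-antisym (greedy-⊆ greedyB′ greedyB) (greedy-⊆ greedyB greedyB′)
    where
    -- Both bases meet the step of the chain containing e in its unique minor base.
    greedy-⊆ : ∀ {B₁ B₂} → IsGreedy B₁ → IsGreedy B₂ → B₁ ⊆ B₂
    greedy-⊆ {B₁} {B₂} greedy₁ greedy₂ {e} e∈B₁ = p∩q⊆p B₂ D (subst (e ∈_) same (x∈p∩q⁺ (e∈B₁ , e∈D)))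
      where
      j = toℕ (lookup f e)
      D = level f (suc j) ─ level f j
      e∈D : e ∈ D
      e∈D = x∈p∧x∉q⇒x∈p─q (∈-level⁺ f ≤-refl) (<-irrefl refl ∘ ∈-level⁻ f)
      unique = proj₂ (proj₂ (splits j))
      same : B₁ ∩ D ≡ B₂ ∩ D
      same = trans (unique _ (greedy-minorBase greedy₁ j)) (sym (unique _ (greedy-minorBase greedy₂ j)))

  generic⇔chainSplits : IsGeneric M f ⇔ ChainSplits M (level f)
  generic⇔chainSplits =
    ⇔-trans generic⇔uniqueGreedyBase (mk⇔ uniqueGreedyBase⇒chainSplits chainSplits⇒uniqueGreedyBase)

-- Weak flags

-- The level sets of a function with exponents β form a weak flag; flagOf drops the sets repeated at
-- the zeros of β, leaving a flag of type compress β.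
record IsWeakFlag {k : ℕ} (W : ℕ → Subset n) (β : Vec ℕ k) : Set where
  field
    step : ∀ j → W j ⊆ W (suc j)
    size : ∀ i → ∣ W (suc (toℕ i)) ∣ ≡ lookup β i + ∣ W (toℕ i) ∣
    top  : ∀ j → k ≤ j → W j ≡ ⊤

open IsWeakFlag

module _ {k : ℕ} {W : ℕ → Subset n} {b : ℕ} {β : Vec ℕ k} where

  weakFlag-tail : IsWeakFlag W (b ∷ β) → IsWeakFlag (W ∘ suc) β
  weakFlag-tail weak = record
    { step = step weak ∘ suc ; size = size weak ∘ suc ; top = λ j k≤j → top weak (suc j) (s≤s k≤j) }

  weakFlag-∷ : W 0 ⊆ W 1 → ∣ W 1 ∣ ≡ b + ∣ W 0 ∣ → IsWeakFlag (W ∘ suc) β → IsWeakFlag W (b ∷ β)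
  weakFlag-∷ W0⊆W1 ∣W1∣ weak = record
    { step = λ { zero → W0⊆W1 ; (suc j) → step weak j }
    ; size = λ { zero → ∣W1∣ ; (suc i) → size weak i }
    ; top  = λ { zero () ; (suc j) (s≤s k≤j) → top weak j k≤j } }

weakFlag-0-step : ∀ {k} {W : ℕ → Subset n} {β : Vec ℕ k} → IsWeakFlag W (0 ∷ β) → W 0 ≡ W 1
weakFlag-0-step weak = ⊆∧∣∣≤⇒≡ (step weak 0) (≤-reflexive (size weak zero))

weakFlag-mono : ∀ {k} {W : ℕ → Subset n} {β : Vec ℕ k} → IsWeakFlag W β → ∀ {i j} → i ≤ j → W i ⊆ W j
weakFlag-mono {W = W} weak = go ∘ ≤⇒≤′
  where
  go : ∀ {i j} → i ≤′ j → W i ⊆ W j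
  go (≤′-reflexive refl) = id
  go (≤′-step i≤′j) = step weak _ ∘ go i≤′j

flagOf : ∀ {k} → (ℕ → Subset n) → Vec ℕ k → List (Subset n)
flagOf W []          = []
flagOf W (zero ∷ β)  = flagOf (W ∘ suc) β
flagOf W (suc b ∷ β) = W 1 ∷ flagOf (W ∘ suc) β

flagOf-cong : ∀ {k} {V W : ℕ → Subset n} (β : Vec ℕ k) → (∀ j → V j ≡ W j) → flagOf V β ≡ flagOf W β
flagOf-cong []          V≗W = refl
flagOf-cong (zero ∷ β)  V≗W = flagOf-cong β (V≗W ∘ suc)
flagOf-cong (suc b ∷ β) V≗W = cong₂ _∷_ (V≗W 1) (flagOf-cong β (V≗W ∘ suc))

-- Reinserts the sets that flagOf drops.
expand : ∀ {k} → Vec ℕ k → Subset n → List (Subset n) → ℕ → Subset n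
expand β           prev As       zero    = prev
expand []          prev As       (suc j) = prev
expand (zero ∷ β)  prev As       (suc j) = expand β prev As j
expand (suc b ∷ β) prev []       (suc j) = prev
expand (suc b ∷ β) prev (A ∷ As) (suc j) = expand β A As j

weakFlag-expand : ∀ {k} {W : ℕ → Subset n} (β : Vec ℕ k) → IsWeakFlag W β →
                  ∀ j → W j ≡ expand β (W 0) (flagOf W β) j
weakFlag-expand β           weak zero    = refl
weakFlag-expand []          weak (suc j) = trans (top weak (suc j) z≤n) (sym (top weak 0 z≤n))
weakFlag-expand {W = W} (zero ∷ β)  weak (suc j) =
  trans (weakFlag-expand β (weakFlag-tail weak) j)
        (cong (λ S → expand β S (flagOf (W ∘ suc) β) j) (sym (weakFlag-0-step weak)))
weakFlag-expand (suc b ∷ β) weak (suc j) = weakFlag-expand β (weakFlag-tail weak) j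

module _ (M : Matroid n) where

  weakFlag⇒flagFrom : ∀ {k} {W : ℕ → Subset n} (β : Vec ℕ k) → IsWeakFlag W β → ChainSplits M W →
                      FlagFrom M (W 0) (compress (toList β)) (flagOf W β)
  weakFlag⇒flagFrom []          weak splits = top weak 0 z≤n
  weakFlag⇒flagFrom {W = W} (zero ∷ β)  weak splits =
    subst (λ S → FlagFrom M S (compress (toList β)) (flagOf (W ∘ suc) β)) (sym (weakFlag-0-step weak))
      (weakFlag⇒flagFrom β (weakFlag-tail weak) (splits ∘ suc))
  weakFlag⇒flagFrom (suc b ∷ β) weak splits =
    step weak 0 , size weak zero , splits 0 , weakFlag⇒flagFrom β (weakFlag-tail weak) (splits ∘ suc)

  flagFrom⇒weakFlag : ∀ {k} (β : Vec ℕ k) {prev As} → FlagFrom M prev (compress (toList β)) As →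
                      IsWeakFlag (expand β prev As) β
  flagFrom⇒weakFlag [] {As = []} prev≡⊤ = record
    { step = λ { zero → id ; (suc j) → id }
    ; size = λ ()
    ; top  = λ { zero _ → prev≡⊤ ; (suc j) _ → prev≡⊤ } }
  flagFrom⇒weakFlag (zero ∷ β) flag = weakFlag-∷ id refl (flagFrom⇒weakFlag β flag)
  flagFrom⇒weakFlag (suc b ∷ β) {As = A ∷ As} (prev⊆A , ∣A∣ , _ , flag) =
    weakFlag-∷ prev⊆A ∣A∣ (flagFrom⇒weakFlag β flag)

  flagFrom⇒chainSplits : ∀ {k} (β : Vec ℕ k) {prev As} → FlagFrom M prev (compress (toList β)) As →
                         ChainSplits M (expand β prev As)
  flagFrom⇒chainSplits [] {prev} {[]} _ zero    = splitsCompletely-refl M prev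
  flagFrom⇒chainSplits [] {prev} {[]} _ (suc j) = splitsCompletely-refl M prev
  flagFrom⇒chainSplits (zero ∷ β) {prev} flag zero    = splitsCompletely-refl M prev
  flagFrom⇒chainSplits (zero ∷ β) flag (suc j) = flagFrom⇒chainSplits β flag j
  flagFrom⇒chainSplits (suc b ∷ β) {As = A ∷ As} (_ , _ , splits , flag) zero    = splits
  flagFrom⇒chainSplits (suc b ∷ β) {As = A ∷ As} (_ , _ , _ , flag)      (suc j) =
    flagFrom⇒chainSplits β flag j

  flagOf-expand : ∀ {k} (β : Vec ℕ k) {prev As} → FlagFrom M prev (compress (toList β)) As →
                  flagOf (expand β prev As) β ≡ As
  flagOf-expand [] {As = []} _ = refl
  flagOf-expand (zero ∷ β) flag = flagOf-expand β flag
  flagOf-expand (suc b ∷ β) {As = A ∷ As} (_ , _ , _ , flag) = cong (A ∷_) (flagOf-expand β flag)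

module _ {k : ℕ} {β : Vec ℕ k} where

  hasExponents⇔weakFlag : (f : Vec (Fin k) n) → HasExponents β f ⇔ IsWeakFlag (level f) β
  hasExponents⇔weakFlag f = mk⇔
    (λ exponents → record
      { step = λ j → level-mono f (n≤1+n j)
      ; size = λ i → trans (level-size f i) (cong (_+ _) (exponents i))
      ; top  = λ j → level-top f })
    (λ weak i → +-cancelʳ-≡ _ _ _ (trans (sym (level-size f i)) (size weak i)))

  weakFlag-cong : ∀ {V W : ℕ → Subset n} → (∀ j → V j ≡ W j) → IsWeakFlag W β → IsWeakFlag V β
  weakFlag-cong {V} {W} V≗W weak = record
    { step = λ j → subst₂ _⊆_ (sym (V≗W j)) (sym (V≗W (suc j))) (step weak j)
    ; size = λ i → subst₂ (λ S S′ → ∣ S′ ∣ ≡ lookup β i + ∣ S ∣) (sym (V≗W (toℕ i))) (sym (V≗W (suc (toℕ i))))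
                     (size weak i)
    ; top  = λ j k≤j → trans (V≗W j) (top weak j k≤j) }

  flagOfLevels-injective : ∀ (f g : Vec (Fin k) n) → HasExponents β f → HasExponents β g →
                           flagOf (level f) β ≡ flagOf (level g) β → f ≡ g
  flagOfLevels-injective f g exponentsF exponentsG same = level-injective f g λ j → begin
    level f j                                          ≡⟨ weakFlag-expand β weakF j ⟩
    expand β (level f 0) (flagOf (level f) β) j        ≡⟨ cong₂ (λ S As → expand β S As j) level-0-≡ same ⟩
    expand β (level g 0) (flagOf (level g) β) j        ≡⟨ sym (weakFlag-expand β weakG j) ⟩
    level g j                                          ∎
    where
    open ≡-Reasoning
    weakF = Equivalence.to (hasExponents⇔weakFlag f) exponentsF
    weakG = Equivalence.to (hasExponents⇔weakFlag g) exponentsG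
    level-0-≡ = trans (level-0 f) (sym (level-0 g))

firstEntry : ∀ k (W : ℕ → Subset n) {e} → e ∉ W 0 → e ∈ W k →
             Σ (Fin k) λ i → e ∉ W (toℕ i) × e ∈ W (suc (toℕ i))
firstEntry zero    W e∉W0 e∈W0 = ⊥-elim (e∉W0 e∈W0)
firstEntry (suc k) W {e} e∉W0 e∈Wk with e ∈? W 1
... | yes e∈W1 = zero , e∉W0 , e∈W1
... | no e∉W1 = let i , e∉ , e∈ = firstEntry k (W ∘ suc) e∉W1 e∈Wk in suc i , e∉ , e∈

module FromWeakFlag {k : ℕ} {W : ℕ → Subset n} {β : Vec ℕ k} (weak : IsWeakFlag W β) (W0≡∅ : W 0 ≡ ∅) where

  entry : ∀ e → Σ (Fin k) λ i → e ∉ W (toℕ i) × e ∈ W (suc (toℕ i))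
  entry e = firstEntry k W (subst (e ∉_) (sym W0≡∅) ∉⊥) (subst (e ∈_) (sym (top weak k ≤-refl)) ∈⊤)

  fromWeakFlag : Vec (Fin k) n
  fromWeakFlag = tabulate (proj₁ ∘ entry)

  level-fromWeakFlag : ∀ j → level fromWeakFlag j ≡ W j
  level-fromWeakFlag j = ⊆-antisym ⊆W ⊇W
    where
    value≡ : ∀ e → toℕ (lookup fromWeakFlag e) ≡ toℕ (proj₁ (entry e))
    value≡ e = cong toℕ (lookup∘tabulate (proj₁ ∘ entry) e)
    ⊆W : level fromWeakFlag j ⊆ W j
    ⊆W {e} e∈ = weakFlag-mono weak (subst (_< j) (value≡ e) (∈-level⁻ fromWeakFlag e∈)) (proj₂ (proj₂ (entry e)))
    ⊇W : W j ⊆ level fromWeakFlag j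
    ⊇W {e} e∈Wj = ∈-level⁺ fromWeakFlag (subst (_< j) (sym (value≡ e))
                    (≰⇒> λ j≤i → proj₁ (proj₂ (entry e)) (weakFlag-mono weak j≤i e∈Wj)))

  fromWeakFlag-exponents : HasExponents β fromWeakFlag
  fromWeakFlag-exponents =
    Equivalence.from (hasExponents⇔weakFlag _) (weakFlag-cong level-fromWeakFlag weak)

-- Counting

map⁺-injectiveOn : ∀ {A B : Set} {P : A → Set} (g : A → B) {xs : List A} → All P xs →
                   (∀ {x y} → P x → P y → g x ≡ g y → x ≡ y) → Unique xs → Unique (map g xs)
map⁺-injectiveOn g []         inj []           = []
map⁺-injectiveOn g (px ∷ pxs) inj (x∉xs ∷ xs!) =
  Allₚ.map⁺ (All.zipWith (λ (py , x≢y) → x≢y ∘ inj px py) (pxs , x∉xs)) ∷ map⁺-injectiveOn g pxs inj xs!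

HasCount-filter : ∀ {A : Set} {P : A → Set} (P? : ∀ x → Dec (P x)) (xs : List A) → Unique xs →
                  (∀ x → x ∈ₗ xs) → HasCount P (length (filter P? xs))
HasCount-filter P? xs xs! complete =
  filter P? xs , Unique.filter⁺ P? xs! ,
  (λ x → mk⇔ (proj₂ ∘ ∈-filter⁻ P? {xs = xs}) (∈-filter⁺ P? (complete x))) , refl

HasCount-image : ∀ {A B : Set} {P : A → Set} {Q : B → Set} {c} → HasCount P c → (g : A → B) →
                 (∀ {x y} → P x → P y → g x ≡ g y → x ≡ y) → (∀ b → Q b ⇔ ∃ λ a → P a × g a ≡ b) →
                 HasCount Q c
HasCount-image {Q = Q} (xs , xs! , ∈⇔P , length≡c) g inj image =
  map g xs , map⁺-injectiveOn g (All.tabulate (Equivalence.to (∈⇔P _))) inj xs! ,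
  (λ b → mk⇔ (to b) (from b)) , trans (length-map g xs) length≡c
  where
  to : ∀ b → b ∈ₗ map g xs → Q b
  to b b∈ = let a , a∈ , b≡ga = ∈-map⁻ g b∈ in
    Equivalence.from (image b) (a , Equivalence.to (∈⇔P a) a∈ , sym b≡ga)
  from : ∀ b → Q b → b ∈ₗ map g xs
  from b Qb = let a , Pa , ga≡b = Equivalence.to (image b) Qb in
    subst (_∈ₗ map g xs) ga≡b (∈-map⁺ g (Equivalence.from (∈⇔P a) Pa))

vectors : ∀ k n → List (Vec (Fin k) n)
vectors k zero    = [] ∷ []
vectors k (suc n) = cartesianProductWith _∷_ (allFin k) (vectors k n)

∈-vectors : ∀ {k n} (v : Vec (Fin k) n) → v ∈ₗ vectors k n
∈-vectors []      = here refl
∈-vectors (x ∷ v) = ∈-cartesianProductWith⁺ _∷_ (∈-allFin x) (∈-vectors v)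

vectors-unique : ∀ k n → Unique (vectors k n)
vectors-unique k zero    = [] ∷ []
vectors-unique k (suc n) = Unique.cartesianProductWith⁺ _∷_ ∷-injective (Unique.allFin⁺ k) (vectors-unique k n)

allSubsets? : ∀ {P : Subset n → Set} → (∀ p → Dec (P p)) → Dec (∀ p → P p)
allSubsets? P? with anySubset? (¬? ∘ P?)
... | yes (p , ¬Pp) = no λ ∀P → ¬Pp (∀P p)
... | no ∄¬P = yes λ p → decidable-stable (P? p) (λ ¬Pp → ∄¬P (p , ¬Pp))

genericWithExponents? : ∀ {k} (M : Matroid n) (β : Vec ℕ k) f → Dec (GenericWithExponents M β f)
genericWithExponents? M β f = generic? ×-dec Fin.all? (λ i → count (_≟ᶠ i) f ≟ lookup β i)
  where
  generic? = anySubset? λ B → isBase? M B ×-dec allSubsets? λ B′ →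
    isBase? M B′ →-dec (¬? (≡-dec _≟ᵇ_ B′ B) →-dec (weight f B <? weight f B′))

module _ (M : Matroid n) {k : ℕ} (β : Vec ℕ k) where

  flagOfLevels-good : ∀ {f} → GenericWithExponents M β f →
                      GoodFlag M (compress (toList β)) (flagOf (level f) β)
  flagOfLevels-good {f} (generic , exponents) =
    subst (λ S → FlagFrom M S (compress (toList β)) (flagOf (level f) β)) (level-0 f)
      (weakFlag⇒flagFrom M β (Equivalence.to (hasExponents⇔weakFlag f) exponents)
                             (Equivalence.to (Greedy.generic⇔chainSplits M f) generic))

  goodFlag⇒flagOfLevels : ∀ {As} → GoodFlag M (compress (toList β)) As →
                          ∃ λ f → GenericWithExponents M β f × flagOf (level f) β ≡ As
  goodFlag⇒flagOfLevels {As} good = fromWeakFlag , (generic , fromWeakFlag-exponents) , flag≡As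
    where
    open FromWeakFlag (flagFrom⇒weakFlag M β good) refl
    generic : IsGeneric M fromWeakFlag
    generic = Equivalence.from (Greedy.generic⇔chainSplits M fromWeakFlag) λ j →
      subst₂ (SplitsCompletely M) (sym (level-fromWeakFlag j)) (sym (level-fromWeakFlag (suc j)))
        (flagFrom⇒chainSplits M β good j)
    flag≡As : flagOf (level fromWeakFlag) β ≡ As
    flag≡As = trans (flagOf-cong β level-fromWeakFlag) (flagOf-expand M β good)

  goodFlag⇔flagOfLevels : ∀ As → GoodFlag M (compress (toList β)) As ⇔
                                 ∃ λ f → GenericWithExponents M β f × flagOf (level f) β ≡ As
  goodFlag⇔flagOfLevels As =
    mk⇔ goodFlag⇒flagOfLevels λ { (f , genericF , refl) → flagOfLevels-good genericF }

proposition3p3 : (n : ℕ) (M : Matroid n) (k : ℕ) (β : Vec ℕ k) →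
    Σ ℕ λ c → HasCount (GenericWithExponents M β) c
            × HasCount (GoodFlag M (compress (toList β))) c
proposition3p3 n M k β =
  length (filter (genericWithExponents? M β) (vectors k n)) , generics ,
  HasCount-image generics (λ f → flagOf (level f) β)
    (λ (_ , exponentsF) (_ , exponentsG) → flagOfLevels-injective {β = β} _ _ exponentsF exponentsG)
    (goodFlag⇔flagOfLevels M β)
  where
  generics = HasCount-filter (genericWithExponents? M β) (vectors k n) (vectors-unique k n) ∈-vectors
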